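{- Let $n$ be even, let $j_1<j_2<\cdots<j_k$ be positive integers less than $n/2$, and let $J(n)=\{j_1,\ldots,j_k,n/2\}$, with $\mathrm{Ci}_n(J(n))$ connected. Then \[\operatorname{gon}(\mathrm{Ci}_n(J(n)))\le 4\sum_{\alpha=1}^k j_\alpha^2.\]
   Context: For $J\subset\{1,\ldots,\lfloor n/2\rfloor\}$, the circulant graph $\mathrm{Ci}_n(J)$ has vertices $v_1,\ldots,v_n$ with $v_i$ adjacent to $v_m$ iff $|i-m|\bmod n\in J$. For a connected loopless multigraph $G$: a divisor is a function $D:V(G)\to\mathbb{Z}$; effective if all values are $\ge0$; degree $\sum_vD(v)$. Firing a vertex $v$ moves one chip from $v$ along each incident edge; divisors are equivalent if related by a sequence of firings. $D$ has positive rank if for every vertex $q$, $D-q$ is equivalent to an effective divisor. $\operatorname{gon}(G)$ is the minimum degree of a positive rank divisor. -}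

module Defs where

open import Data.Nat as ℕ using (ℕ; zero; suc; _≡ᵇ_; ∣_-_∣; _⊓_; _∸_)
open import Data.Integer as ℤ using (ℤ; +_; 0ℤ; 1ℤ)
open import Data.Fin as Fin using (Fin; toℕ)
open import Data.Bool using (Bool; true; false; if_then_else_)
open import Data.List using (List; []; _∷_; map; foldr)
open import Data.Bool.ListAction using (any)
open import Data.Product using (Σ; ∃; _×_; _,_)
open import Relation.Binary.PropositionalEquality using (_≡_)
open import Relation.Nullary using (yes; no)
open import Relation.Binary.Construct.Closure.Equivalence using (EqClosure)
open import Relation.Binary.Construct.Closure.ReflexiveTransitive using (Star)

-- Finite (loopless) graphs on vertex set Fin n, given by a Boolean
-- adjacency function (simple graph: edge multiplicity 0 or 1).

record Graph : Set where
  field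
    size : ℕ
    adj  : Fin size → Fin size → Bool
open Graph public

sumFin : ∀ {n} → (Fin n → ℤ) → ℤ
sumFin {zero}  f = 0ℤ
sumFin {suc n} f = f Fin.zero ℤ.+ sumFin (λ i → f (Fin.suc i))

Connected : Graph → Set
Connected G = ∀ (u v : Fin (size G)) → Star (λ a b → adj G a b ≡ true) u v

Divisor : Graph → Set
Divisor G = Fin (size G) → ℤ

deg : ∀ {G} → Divisor G → ℤ
deg = sumFin

Effective : ∀ {G} → Divisor G → Set
Effective {G} D = ∀ (v : Fin (size G)) → 0ℤ ℤ.≤ D v

edge : (G : Graph) → Fin (size G) → Fin (size G) → ℤ
edge G v w = if adj G v w then 1ℤ else 0ℤ

valence : (G : Graph) → Fin (size G) → ℤ
valence G v = sumFin (λ w → edge G v w)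

fire : (G : Graph) → Fin (size G) → Divisor G → Divisor G
fire G v D w with Fin._≟_ w v
... | yes _ = D w ℤ.- valence G v
... | no  _ = D w ℤ.+ edge G v w

FireStep : (G : Graph) → Divisor G → Divisor G → Set
FireStep G D D' = ∃ λ v → ∀ w → D' w ≡ fire G v D w

-- equivalence of divisors: related by a sequence of firings, i.e. the
-- equivalence closure  EqClosure (FireStep G)  (used below)

minusPt : ∀ {G} → Divisor G → Fin (size G) → Divisor G
minusPt {G} D q w with Fin._≟_ w q
... | yes _ = D w ℤ.- 1ℤ
... | no  _ = D w

PositiveRank : (G : Graph) → Divisor G → Set
PositiveRank G D = ∀ (q : Fin (size G)) →
  Σ (Divisor G) λ E → Effective {G} E × EqClosure (FireStep G) (minusPt {G} D q) E

-- gon(G) ≤ b  :⇔  some positive rank divisor has degree ≤ b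
-- (the minimum defining gon is ≤ b iff such a divisor exists)
GonLe : Graph → ℤ → Set
GonLe G b = Σ (Divisor G) λ D → PositiveRank G D × deg {G} D ℤ.≤ b

memᵇ : ℕ → List ℕ → Bool
memᵇ x = any (λ y → x ≡ᵇ y)

Ci : (n : ℕ) → List ℕ → Graph
Ci n J = record
  { size = n
  ; adj  = λ i m → let d = ∣ toℕ i - toℕ m ∣ in memᵇ (d ⊓ (n ∸ d)) J
  }

sumℕ : List ℕ → ℕ
sumℕ = foldr ℕ._+_ 0

{-# OPTIONS --safe #-}

-- Write m = n/2 and let δ x be the distance from x to the nearest multiple of m, so that δ vanishes exactly
-- at the antipodal vertices 0 and m. The divisor D₀ puts ∑ⱼ 2 (j − δ x)⁺ chips on x, and summing over x
-- gives at most 4 j² for each j. To free a chip at q, fire every vertex v exactly (δ q − δ v)⁺ times. As δ is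
-- m-periodic, the chords of length m move no net chips. For j < m and Φ = (δ q − δ)⁺, the chords of
-- length j leave 2 (j − δ x)⁺ + Φ (x + j) + Φ (x − j) − 2 Φ x chips on x. Both neighbours have δ ≤ δ x + j
-- and one of them has δ ≤ ∣ δ x − j ∣; as s ↦ (s − ·)⁺ is antitone, 1-Lipschitz and convex, this never
-- drops below 0, and at x = q it is at least 1.

module Submission where

open import Defs

-- ℤ's _+_, _*_ and _≤_ are opened unqualified in here, whereas the statement of theorem3p3 uses ℕ's.
module ChipFiring where

  open import Data.Bool using (Bool; true; false; if_then_else_)
  open import Data.Bool.Properties using (T-≡; ¬-not)
  open import Data.Fin using (Fin; zero; suc; toℕ; fromℕ<; punchIn; opposite)
  open import Data.Fin.Properties using (_≟_)
  import Data.Fin.Properties as FinP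
  open import Data.Fin.Permutation using (reverse)
  open import Data.Integer using (ℤ; +_; 0ℤ; 1ℤ; _+_; _-_; _*_; -_; _≤_; +≤+; _⊖_)
  import Data.Integer.Properties as ℤP
  open import Data.Integer.Tactic.RingSolver using (solve-∀)
  open import Data.List using (_++_; [_]; map)
  open import Data.Nat as ℕ using (ℕ; zero; suc; NonZero; _∸_; _⊓_; ∣_-_∣; z≤n; s≤s)
  import Data.Nat.Properties as ℕP
  open import Data.Nat.DivMod
    using (_%_; _/_; m<n⇒m%n≡m; [m+n]%n≡m%n; [m+kn]%n≡m%n; m∣n⇒o%n%m≡o%m; m*n%n≡0; m≡m%n+[m/n]*n; m%n<n; n%n≡0)
  open import Data.Nat.Divisibility using (_∣_; ∣-refl; ∣m∣n⇒∣m+n)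
  import Data.Nat.Tactic.RingSolver as ℕSolver
  open import Data.Product using (Σ-syntax; _×_; _,_; proj₁; proj₂)
  open import Data.Sum using (_⊎_; inj₁; inj₂; [_,_]′)
  open import Data.Vec using (Vec; []; _∷_; lookup; toList)
  open import Function using (_∘_; Equivalence)
  open import Relation.Binary.Construct.Closure.Equivalence using (EqClosure)
  open import Relation.Binary.Construct.Closure.ReflexiveTransitive using (ε; _◅_; _◅◅_)
  open import Relation.Binary.Construct.Closure.Symmetric using (fwd; bwd)
  open import Relation.Binary.Definitions using (tri<; tri≈; tri>)
  open import Relation.Binary.PropositionalEquality
    using (_≡_; _≢_; refl; sym; trans; cong; cong₂; subst; module ≡-Reasoning)
  open import Relation.Nullary using (yes; no; contradiction)

  open import Algebra.Properties.Semiring.Sum ℤP.+-*-semiring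

  χ : Bool → ℤ
  χ b = if b then 1ℤ else 0ℤ

  sumFin≡sum : ∀ {n} (f : Fin n → ℤ) → sumFin f ≡ sum f
  sumFin≡sum {zero}  f = refl
  sumFin≡sum {suc n} f = cong (_+_ (f zero)) (sumFin≡sum (f ∘ suc))

  ∑-zero : ∀ {n} (f : Fin n → ℤ) → (∀ i → f i ≡ 0ℤ) → sum f ≡ 0ℤ
  ∑-zero {n} f f≗0 = trans (sum-cong-≗ f≗0) (sum-replicate-zero n)

  ∑-single : ∀ {n} (f : Fin n → ℤ) j → (∀ i → i ≢ j → f i ≡ 0ℤ) → sum f ≡ f j
  ∑-single {suc n} f j f≗0 = begin
    sum f                        ≡⟨ sum-remove f ⟩
    f j + sum (f ∘ punchIn j) ≡⟨ cong (_+_ (f j)) (∑-zero _ (λ i → f≗0 _ (FinP.punchInᵢ≢i j i))) ⟩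
    f j + 0ℤ                     ≡⟨ ℤP.+-identityʳ (f j) ⟩
    f j                          ∎
    where open ≡-Reasoning

  ∑-split : ∀ a b (f : ℕ → ℤ) →
            ∑[ i < a ℕ.+ b ] f (toℕ i) ≡ ∑[ i < a ] f (toℕ i) + ∑[ i < b ] f (a ℕ.+ toℕ i)
  ∑-split zero    b f = sym (ℤP.+-identityˡ _)
  ∑-split (suc a) b f = trans (cong (_+_ (f 0)) (∑-split a b (f ∘ suc))) (sym (ℤP.+-assoc (f 0) _ _))

  ∑-cong-< : ∀ {n} {f g : ℕ → ℤ} → (∀ x → x ℕ.< n → f x ≡ g x) → ∑[ i < n ] f (toℕ i) ≡ ∑[ i < n ] g (toℕ i)
  ∑-cong-< f≗g = sum-cong-≗ (λ i → f≗g (toℕ i) (FinP.toℕ<n i))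

  ∑-rotate : ∀ {n} .{{_ : NonZero n}} {i} (f : ℕ → ℤ) → i ℕ.< n →
             ∑[ u < n ] f (toℕ u) ≡ ∑[ u < n ] f ((i ℕ.+ toℕ u) % n)
  ∑-rotate {n} {i} f i<n = begin
    ∑[ u < n ] f (toℕ u)                                 ≡⟨ cong (λ t → ∑[ u < t ] f (toℕ u)) (sym i+k≡n) ⟩
    ∑[ u < i ℕ.+ k ] f (toℕ u)                           ≡⟨ ∑-split i k f ⟩
    ∑[ u < i ] f (toℕ u) + ∑[ u < k ] f (i ℕ.+ toℕ u)    ≡⟨ ℤP.+-comm (∑[ u < i ] f (toℕ u)) _ ⟩
    ∑[ u < k ] f (i ℕ.+ toℕ u) + ∑[ u < i ] f (toℕ u)    ≡⟨ cong₂ _+_ (∑-cong-< below) (∑-cong-< wrapped) ⟩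
    ∑[ u < k ] g (toℕ u) + ∑[ u < i ] g (k ℕ.+ toℕ u)    ≡⟨ ∑-split k i g ⟨
    ∑[ u < k ℕ.+ i ] g (toℕ u)                           ≡⟨ cong (λ t → ∑[ u < t ] g (toℕ u)) (trans (ℕP.+-comm k i) i+k≡n) ⟩
    ∑[ u < n ] g (toℕ u)                                 ∎
    where
    open ≡-Reasoning
    k = n ∸ i
    i+k≡n : i ℕ.+ k ≡ n
    i+k≡n = ℕP.m+[n∸m]≡n (ℕP.<⇒≤ i<n)
    g : ℕ → ℤ
    g u = f ((i ℕ.+ u) % n)
    below : ∀ x → x ℕ.< k → f (i ℕ.+ x) ≡ g x
    below x x<k = cong f (sym (m<n⇒m%n≡m (subst (i ℕ.+ x ℕ.<_) i+k≡n (ℕP.+-monoʳ-< i x<k))))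
    wrapped : ∀ x → x ℕ.< i → f x ≡ g (k ℕ.+ x)
    wrapped x x<i = cong f (sym (begin
      (i ℕ.+ (k ℕ.+ x)) % n  ≡⟨ cong (_% n) (trans (sym (ℕP.+-assoc i k x)) (trans (cong (ℕ._+ x) i+k≡n) (ℕP.+-comm n x))) ⟩
      (x ℕ.+ n) % n          ≡⟨ [m+n]%n≡m%n x n ⟩
      x % n                  ≡⟨ m<n⇒m%n≡m (ℕP.<-trans x<i i<n) ⟩
      x                      ∎))

  ∑-nonneg : ∀ {n} (f : Fin n → ℤ) → (∀ i → 0ℤ ≤ f i) → 0ℤ ≤ sum f
  ∑-nonneg {zero}  f f≥0 = ℤP.≤-refl
  ∑-nonneg {suc n} f f≥0 = ℤP.+-mono-≤ (f≥0 zero) (∑-nonneg (f ∘ suc) (f≥0 ∘ suc))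

  ∑-mono-≤ : ∀ {n} (f g : Fin n → ℤ) → (∀ i → f i ≤ g i) → sum f ≤ sum g
  ∑-mono-≤ {zero}  f g f≤g = ℤP.≤-refl
  ∑-mono-≤ {suc n} f g f≤g = ℤP.+-mono-≤ (f≤g zero) (∑-mono-≤ (f ∘ suc) (g ∘ suc) (f≤g ∘ suc))

  ≡ᵇ-refl : ∀ n → (n ℕ.≡ᵇ n) ≡ true
  ≡ᵇ-refl n = Equivalence.to T-≡ (ℕP.≡⇒≡ᵇ n n refl)

  ≡ᵇ-≢ : ∀ {m n} → m ≢ n → (m ℕ.≡ᵇ n) ≡ false
  ≡ᵇ-≢ {m} {n} m≢n = ¬-not (m≢n ∘ ℕP.≡ᵇ⇒≡ m n ∘ Equivalence.from T-≡)

  ∑-pick : ∀ {n} (h : ℕ → ℤ) {d} → d ℕ.< n →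
           ∑[ u < n ] (χ (toℕ u ℕ.≡ᵇ d) * h (toℕ u)) ≡ h d
  ∑-pick h {d} d<n = trans (∑-single _ (fromℕ< d<n) off) on
    where
    off : ∀ u → u ≢ fromℕ< d<n → χ (toℕ u ℕ.≡ᵇ d) * h (toℕ u) ≡ 0ℤ
    off u u≢d = cong (λ b → χ b * h (toℕ u))
                     (≡ᵇ-≢ λ u≡d → u≢d (FinP.toℕ-injective (trans u≡d (sym (FinP.toℕ-fromℕ< d<n)))))
    on : χ (toℕ (fromℕ< d<n) ℕ.≡ᵇ d) * h (toℕ (fromℕ< d<n)) ≡ h d
    on rewrite FinP.toℕ-fromℕ< d<n | ≡ᵇ-refl d = ℤP.*-identityˡ (h d)

  module Firing (G : Graph) where

    V : Set
    V = Fin (size G)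

    _∼_ : Divisor G → Divisor G → Set
    _∼_ = EqClosure (FireStep G)

    Δ : V → V → ℤ
    Δ v = fire G v (λ _ → 0ℤ)

    fire≡+Δ : ∀ v D w → fire G v D w ≡ D w + Δ v w
    fire≡+Δ v D w with w ≟ v
    ... | yes _ = cong (_+_ (D w)) (sym (ℤP.+-identityˡ _))
    ... | no  _ = cong (_+_ (D w)) (sym (ℤP.+-identityˡ _))

    -- Up to pointwise equality, as divisors are functions.
    Principal : Divisor G → Set
    Principal P = ∀ D D′ → (∀ w → D′ w ≡ D w + P w) → D ∼ D′

    Δ-principal : ∀ v → Principal (Δ v)
    Δ-principal v D D′ D′≗ = fwd (v , λ w → trans (D′≗ w) (sym (fire≡+Δ v D w))) ◅ ε

    -- Without function extensionality, pointwise equal divisors are only related by firing some vertex and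
    -- then unfiring it, hence the vertex argument here and below.
    0-principal : V → Principal (λ _ → 0ℤ)
    0-principal v D D′ D′≗ = fwd (v , λ _ → refl) ◅ bwd (v , same) ◅ ε
      where
      same : ∀ w → fire G v D w ≡ fire G v D′ w
      same w = begin
        fire G v D w     ≡⟨ fire≡+Δ v D w ⟩
        D w + Δ v w      ≡⟨ cong (_+ Δ v w) (trans (sym (ℤP.+-identityʳ (D w))) (sym (D′≗ w))) ⟩
        D′ w + Δ v w     ≡⟨ fire≡+Δ v D′ w ⟨
        fire G v D′ w    ∎
        where open ≡-Reasoning

    principal-cong : ∀ {P Q} → (∀ w → P w ≡ Q w) → Principal P → Principal Q
    principal-cong P≗Q pP D D′ D′≗ = pP D D′ (λ w → trans (D′≗ w) (cong (_+_ (D w)) (sym (P≗Q w))))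

    principal-+ : ∀ {P Q} → Principal P → Principal Q → Principal (λ w → P w + Q w)
    principal-+ {P} pP pQ D D′ D′≗ =
      pP D (λ w → D w + P w) (λ _ → refl) ◅◅ pQ _ D′ (λ w → trans (D′≗ w) (sym (ℤP.+-assoc (D w) _ _)))

    principal-* : V → ∀ c {P} → Principal P → Principal (λ w → + c * P w)
    principal-* v zero {P} pP = principal-cong (λ w → sym (ℤP.*-zeroˡ (P w))) (0-principal v)
    principal-* v (suc c) {P} pP = principal-cong 1+c (principal-+ pP (principal-* v c pP))
      where
      1+c : ∀ w → P w + + c * P w ≡ + suc c * P w
      1+c w = trans (cong (_+ + c * P w) (sym (ℤP.*-identityˡ (P w)))) (sym (ℤP.*-distribʳ-+ (P w) 1ℤ (+ c)))

    principal-∑ : V → ∀ {n} (P : Fin n → Divisor G) → (∀ i → Principal (P i)) → Principal (λ w → ∑[ i < n ] P i w)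
    principal-∑ v {zero}  P pP = 0-principal v
    principal-∑ v {suc n} P pP = principal-+ (pP zero) (principal-∑ v (P ∘ suc) (pP ∘ suc))

    script-principal : V → (φ : V → ℕ) → Principal (λ w → ∑[ v < size G ] (+ φ v * Δ v w))
    script-principal o φ = principal-∑ o (λ v w → + φ v * Δ v w) (λ v → principal-* o (φ v) (Δ-principal v))

    positiveRank-by-principal : ∀ D →
      (∀ q → Σ[ P ∈ Divisor G ] Principal P × Effective {G} (λ w → D w + P w) × 1ℤ ≤ D q + P q) →
      PositiveRank G D
    positiveRank-by-principal D principalFor q with principalFor q
    ... | P , pP , eff , 1≤ = minusPt {G} (λ w → D w + P w) q , eff′ , pP (minusPt {G} D q) _ moved
      where
      eff′ : Effective {G} (minusPt {G} (λ w → D w + P w) q)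
      eff′ w with w ≟ q
      ... | yes refl = ℤP.+-monoˡ-≤ (- 1ℤ) 1≤
      ... | no  _    = eff w
      moved : ∀ w → minusPt {G} (λ w → D w + P w) q w ≡ minusPt {G} D q w + P w
      moved w with w ≟ q
      ... | yes _ = swap (D w) (P w)
        where
        swap : ∀ a p → (a + p) - 1ℤ ≡ (a - 1ℤ) + p
        swap = solve-∀
      ... | no  _ = refl

    Loopless : Set
    Loopless = ∀ v → adj G v v ≡ false

    Undirected : Set
    Undirected = ∀ v w → adj G v w ≡ adj G w v

    laplacian : Loopless → Undirected → (φ : V → ℤ) → ∀ w →
                ∑[ v < size G ] (φ v * Δ v w) ≡ ∑[ v < size G ] (edge G w v * (φ v - φ w))
    laplacian loopless undirected φ w = begin
      ∑[ v < size G ] (φ v * Δ v w)                         ≡⟨ sum-cong-≗ redistribute ⟩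
      ∑[ v < size G ] (flow v + (edge G w v * φ w + loss v)) ≡⟨ ∑-distrib-+ flow _ ⟩
      ∑[ v < size G ] flow v + ∑[ v < size G ] (edge G w v * φ w + loss v)
                                                            ≡⟨ cong (_+_ (sum flow)) balanced ⟩
      ∑[ v < size G ] flow v + 0ℤ                           ≡⟨ ℤP.+-identityʳ (sum flow) ⟩
      ∑[ v < size G ] flow v                                ∎
      where
      open ≡-Reasoning
      flow : V → ℤ
      flow v = edge G w v * (φ v - φ w)
      loss : V → ℤ
      loss v with w ≟ v
      ... | yes _ = - (φ w * valence G w)
      ... | no  _ = 0ℤ
      redistribute : ∀ v → φ v * Δ v w ≡ flow v + (edge G w v * φ w + loss v)
      redistribute v with w ≟ v
      ... | yes refl rewrite loopless w = fired (φ w) (valence G w)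
        where
        fired : ∀ a b → a * (0ℤ - b) ≡ 0ℤ * (a - a) + (0ℤ * a + - (a * b))
        fired = solve-∀
      ... | no  _    rewrite undirected v w = received (φ v) (φ w) (edge G w v)
        where
        received : ∀ a b e → a * (0ℤ + e) ≡ e * (a - b) + (e * b + 0ℤ)
        received = solve-∀
      loss-off : ∀ v → v ≢ w → loss v ≡ 0ℤ
      loss-off v v≢w with w ≟ v
      ... | yes w≡v = contradiction (sym w≡v) v≢w
      ... | no  _   = refl
      loss-at : loss w ≡ - (φ w * valence G w)
      loss-at with w ≟ w
      ... | yes _   = refl
      ... | no  w≢w = contradiction refl w≢w
      balanced : ∑[ v < size G ] (edge G w v * φ w + loss v) ≡ 0ℤ
      balanced = begin
        ∑[ v < size G ] (edge G w v * φ w + loss v)     ≡⟨ ∑-distrib-+ (λ v → edge G w v * φ w) loss ⟩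
        ∑[ v < size G ] (edge G w v * φ w) + sum loss
          ≡⟨ cong₂ _+_ (sym (*-distribʳ-sum (φ w) (edge G w))) (trans (∑-single loss w loss-off) loss-at) ⟩
        sum (edge G w) * φ w + - (φ w * valence G w)
          ≡⟨ cong (λ val → val * φ w + - (φ w * valence G w)) (sym (sumFin≡sum (edge G w))) ⟩
        valence G w * φ w + - (φ w * valence G w)       ≡⟨ cancel (valence G w) (φ w) ⟩
        0ℤ                                              ∎
        where
        cancel : ∀ a b → a * b + - (b * a) ≡ 0ℤ
        cancel = solve-∀

  d≢n∸d : ∀ {n d} → d ℕ.+ d ℕ.< n → d ≢ n ∸ d
  d≢n∸d {n} {d} 2d<n d≡n∸d = ℕP.<-irrefl (trans (cong (d ℕ.+_) d≡n∸d) (ℕP.m+[n∸m]≡n (ℕP.m+n≤o⇒m≤o d (ℕP.<⇒≤ 2d<n)))) 2d<n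

  n∸d≡d : ∀ {n d} → d ℕ.+ d ≡ n → n ∸ d ≡ d
  n∸d≡d {d = d} refl = ℕP.m+n∸n≡m d d

  cyclicDist : ℕ → ℕ → ℕ → ℕ
  cyclicDist n a b = ∣ a - b ∣ ⊓ (n ∸ ∣ a - b ∣)

  cyclicDist-rotate : ∀ {n} .{{_ : NonZero n}} {i u} → i ℕ.< n → u ℕ.< n → cyclicDist n i ((i ℕ.+ u) % n) ≡ u ⊓ (n ∸ u)
  cyclicDist-rotate {n} {i} {u} i<n u<n with i ℕ.+ u ℕ.<? n
  ... | yes i+u<n rewrite m<n⇒m%n≡m i+u<n | ℕP.∣m-m+n∣≡n i u = refl
  ... | no  i+u≮n = begin
    cyclicDist n i ((i ℕ.+ u) % n)            ≡⟨ cong (cyclicDist n i) i+u%n≡y ⟩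
    cyclicDist n i y                          ≡⟨ cong (λ d → d ⊓ (n ∸ d)) ∣i-y∣≡n∸u ⟩
    (n ∸ u) ⊓ (n ∸ (n ∸ u))              ≡⟨ cong ((n ∸ u) ⊓_) (ℕP.m∸[m∸n]≡n (ℕP.<⇒≤ u<n)) ⟩
    (n ∸ u) ⊓ u                          ≡⟨ ℕP.⊓-comm (n ∸ u) u ⟩
    u ⊓ (n ∸ u)                          ∎
    where
    open ≡-Reasoning
    y = i ℕ.+ u ∸ n
    y+n≡i+u : y ℕ.+ n ≡ i ℕ.+ u
    y+n≡i+u = ℕP.m∸n+n≡m (ℕP.≮⇒≥ i+u≮n)
    i+u%n≡y : (i ℕ.+ u) % n ≡ y
    i+u%n≡y = begin
      (i ℕ.+ u) % n   ≡⟨ cong (_% n) y+n≡i+u ⟨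
      (y ℕ.+ n) % n   ≡⟨ [m+n]%n≡m%n y n ⟩
      y % n           ≡⟨ m<n⇒m%n≡m (ℕP.+-cancelʳ-< n y n (subst (ℕ._< n ℕ.+ n) (sym y+n≡i+u) (ℕP.+-mono-< i<n u<n))) ⟩
      y               ∎
    i≡y+[n∸u] : i ≡ y ℕ.+ (n ∸ u)
    i≡y+[n∸u] = ℕP.+-cancelʳ-≡ u i (y ℕ.+ (n ∸ u)) (begin
      i ℕ.+ u               ≡⟨ y+n≡i+u ⟨
      y ℕ.+ n               ≡⟨ cong (y ℕ.+_) (ℕP.m∸n+n≡m (ℕP.<⇒≤ u<n)) ⟨
      y ℕ.+ (n ∸ u ℕ.+ u)   ≡⟨ ℕP.+-assoc y (n ∸ u) u ⟨
      y ℕ.+ (n ∸ u) ℕ.+ u   ∎)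
    ∣i-y∣≡n∸u : ∣ i - y ∣ ≡ n ∸ u
    ∣i-y∣≡n∸u = begin
      ∣ i - y ∣                 ≡⟨ cong ∣_- y ∣ i≡y+[n∸u] ⟩
      ∣ y ℕ.+ (n ∸ u) - y ∣     ≡⟨ ℕP.∣-∣-comm (y ℕ.+ (n ∸ u)) y ⟩
      ∣ y - y ℕ.+ (n ∸ u) ∣     ≡⟨ ℕP.∣m-m+n∣≡n y (n ∸ u) ⟩
      n ∸ u                     ∎

  m⊓[n∸m]≡o⇒m≡o⊎m≡n∸o : ∀ {n u d} → u ℕ.≤ n → u ⊓ (n ∸ u) ≡ d → u ≡ d ⊎ u ≡ n ∸ d
  m⊓[n∸m]≡o⇒m≡o⊎m≡n∸o {n} {u} u≤n eq with ℕP.⊓-sel u (n ∸ u)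
  ... | inj₁ ⊓≡u   = inj₁ (trans (sym ⊓≡u) eq)
  ... | inj₂ ⊓≡n∸u = inj₂ (trans (sym (ℕP.m∸[m∸n]≡n u≤n)) (cong (n ∸_) (trans (sym ⊓≡n∸u) eq)))

  χ-cyclic : ∀ {n u d} → u ℕ.≤ n → d ℕ.+ d ℕ.< n →
             χ (u ⊓ (n ∸ u) ℕ.≡ᵇ d) ≡ χ (u ℕ.≡ᵇ d) + χ (u ℕ.≡ᵇ n ∸ d)
  χ-cyclic {n} {u} {d} u≤n 2d<n with u ℕ.≟ d | u ℕ.≟ n ∸ d
  ... | yes refl | _
    rewrite ℕP.m≤n⇒m⊓n≡m (ℕP.m+n≤o⇒m≤o∸n d (ℕP.<⇒≤ 2d<n)) | ≡ᵇ-refl d | ≡ᵇ-≢ (d≢n∸d {n} {d} 2d<n) = refl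
  ... | no u≢d | yes refl
    rewrite ℕP.m∸[m∸n]≡n (ℕP.m+n≤o⇒n≤o d (ℕP.<⇒≤ 2d<n))
          | ℕP.m≥n⇒m⊓n≡n (ℕP.m+n≤o⇒m≤o∸n d (ℕP.<⇒≤ 2d<n))
          | ≡ᵇ-refl d | ≡ᵇ-≢ u≢d | ≡ᵇ-refl (n ∸ d) = refl
  ... | no u≢d | no u≢n∸d rewrite ≡ᵇ-≢ u≢d | ≡ᵇ-≢ u≢n∸d =
    cong χ (≡ᵇ-≢ λ eq → [ u≢d , u≢n∸d ]′ (m⊓[n∸m]≡o⇒m≡o⊎m≡n∸o u≤n eq))

  χ-antipodal : ∀ {n u d} → u ℕ.≤ n → d ℕ.+ d ≡ n → χ (u ⊓ (n ∸ u) ℕ.≡ᵇ d) ≡ χ (u ℕ.≡ᵇ d)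
  χ-antipodal {n} {u} {d} u≤n 2d≡n with u ℕ.≟ d
  ... | yes refl rewrite n∸d≡d {n} {d} 2d≡n | ℕP.⊓-idem d = refl
  ... | no u≢d rewrite ≡ᵇ-≢ u≢d =
    cong χ (≡ᵇ-≢ λ eq → [ u≢d , (λ u≡n∸d → u≢d (trans u≡n∸d (n∸d≡d {n} {d} 2d≡n))) ]′ (m⊓[n∸m]≡o⇒m≡o⊎m≡n∸o u≤n eq))

  ∑-at-distance : ∀ {n} .{{_ : NonZero n}} {i d} (h : ℕ → ℤ) → i ℕ.< n → 0 ℕ.< d → d ℕ.+ d ℕ.< n →
               ∑[ v < n ] (χ (cyclicDist n i (toℕ v) ℕ.≡ᵇ d) * h (toℕ v)) ≡ h ((i ℕ.+ d) % n) + h ((i ℕ.+ (n ∸ d)) % n)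
  ∑-at-distance {n} {i} {d} h i<n 0<d 2d<n = begin
    ∑[ v < n ] (χ (cyclicDist n i (toℕ v) ℕ.≡ᵇ d) * h (toℕ v))
      ≡⟨ ∑-rotate (λ x → χ (cyclicDist n i x ℕ.≡ᵇ d) * h x) i<n ⟩
    ∑[ u < n ] (χ (cyclicDist n i ((i ℕ.+ toℕ u) % n) ℕ.≡ᵇ d) * g (toℕ u))
      ≡⟨ ∑-cong-< split ⟩
    ∑[ u < n ] (χ (toℕ u ℕ.≡ᵇ d) * g (toℕ u) + χ (toℕ u ℕ.≡ᵇ n ∸ d) * g (toℕ u))
      ≡⟨ ∑-distrib-+ {n} (λ u → χ (toℕ u ℕ.≡ᵇ d) * g (toℕ u)) (λ u → χ (toℕ u ℕ.≡ᵇ n ∸ d) * g (toℕ u)) ⟩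
    ∑[ u < n ] (χ (toℕ u ℕ.≡ᵇ d) * g (toℕ u)) + ∑[ u < n ] (χ (toℕ u ℕ.≡ᵇ n ∸ d) * g (toℕ u))
      ≡⟨ cong₂ _+_ (∑-pick g d<n) (∑-pick g (ℕP.∸-monoʳ-< 0<d (ℕP.<⇒≤ d<n))) ⟩
    g d + g (n ∸ d) ∎
    where
    open ≡-Reasoning
    g : ℕ → ℤ
    g u = h ((i ℕ.+ u) % n)
    d<n : d ℕ.< n
    d<n = ℕP.≤-<-trans (ℕP.m≤m+n d d) 2d<n
    split : ∀ u → u ℕ.< n →
            χ (cyclicDist n i ((i ℕ.+ u) % n) ℕ.≡ᵇ d) * g u ≡ χ (u ℕ.≡ᵇ d) * g u + χ (u ℕ.≡ᵇ n ∸ d) * g u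
    split u u<n = begin
      χ (cyclicDist n i ((i ℕ.+ u) % n) ℕ.≡ᵇ d) * g u  ≡⟨ cong (λ c → χ (c ℕ.≡ᵇ d) * g u) (cyclicDist-rotate i<n u<n) ⟩
      χ (u ⊓ (n ∸ u) ℕ.≡ᵇ d) * g u                     ≡⟨ cong (_* g u) (χ-cyclic (ℕP.<⇒≤ u<n) 2d<n) ⟩
      (χ (u ℕ.≡ᵇ d) + χ (u ℕ.≡ᵇ n ∸ d)) * g u          ≡⟨ ℤP.*-distribʳ-+ (g u) (χ (u ℕ.≡ᵇ d)) _ ⟩
      χ (u ℕ.≡ᵇ d) * g u + χ (u ℕ.≡ᵇ n ∸ d) * g u      ∎

  ∑-at-antipode : ∀ {n} .{{_ : NonZero n}} {i d} (h : ℕ → ℤ) → i ℕ.< n → 0 ℕ.< d → d ℕ.+ d ≡ n →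
                  ∑[ v < n ] (χ (cyclicDist n i (toℕ v) ℕ.≡ᵇ d) * h (toℕ v)) ≡ h ((i ℕ.+ d) % n)
  ∑-at-antipode {n} {i} {d} h i<n 0<d 2d≡n = begin
    ∑[ v < n ] (χ (cyclicDist n i (toℕ v) ℕ.≡ᵇ d) * h (toℕ v))
      ≡⟨ ∑-rotate (λ x → χ (cyclicDist n i x ℕ.≡ᵇ d) * h x) i<n ⟩
    ∑[ u < n ] (χ (cyclicDist n i ((i ℕ.+ toℕ u) % n) ℕ.≡ᵇ d) * g (toℕ u))
      ≡⟨ ∑-cong-< (λ u u<n → cong (λ c → χ (c ℕ.≡ᵇ d) * g u) (cyclicDist-rotate i<n u<n)) ⟩
    ∑[ u < n ] (χ (toℕ u ⊓ (n ∸ toℕ u) ℕ.≡ᵇ d) * g (toℕ u))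
      ≡⟨ ∑-cong-< (λ u u<n → cong (_* g u) (χ-antipodal {n} {u} {d} (ℕP.<⇒≤ u<n) 2d≡n)) ⟩
    ∑[ u < n ] (χ (toℕ u ℕ.≡ᵇ d) * g (toℕ u))
      ≡⟨ ∑-pick g (subst (d ℕ.<_) 2d≡n (ℕP.m<m+n d 0<d)) ⟩
    g d ∎
    where
    open ≡-Reasoning
    g : ℕ → ℤ
    g u = h ((i ℕ.+ u) % n)

  memᵇ-absent : ∀ {k} (v : Vec ℕ k) {e c} → (∀ α → c ≢ lookup v α) → c ≢ e → memᵇ c (toList v ++ [ e ]) ≡ false
  memᵇ-absent []      ≢v c≢e rewrite ≡ᵇ-≢ c≢e = refl
  memᵇ-absent (x ∷ v) ≢v c≢e rewrite ≡ᵇ-≢ (≢v zero) = memᵇ-absent v (≢v ∘ suc) c≢e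

  χ-memᵇ : ∀ {k} (v : Vec ℕ k) {e} c →
           (∀ α β → lookup v α ≡ lookup v β → α ≡ β) → (∀ α → lookup v α ≢ e) →
           χ (memᵇ c (toList v ++ [ e ])) ≡ ∑[ α < k ] χ (c ℕ.≡ᵇ lookup v α) + χ (c ℕ.≡ᵇ e)
  χ-memᵇ [] {e} c _ _ with c ℕ.≟ e
  ... | yes refl rewrite ≡ᵇ-refl c = refl
  ... | no  c≢e  rewrite ≡ᵇ-≢ c≢e = refl
  χ-memᵇ (x ∷ v) {e} c injective ≢e with c ℕ.≟ x
  ... | yes refl rewrite ≡ᵇ-refl c | ≡ᵇ-≢ (≢e zero) =
    cong (λ s → (1ℤ + s) + 0ℤ) (sym (∑-zero _ λ α → cong χ (≡ᵇ-≢ λ c≡vα → FinP.0≢1+n (injective zero (suc α) c≡vα))))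
  ... | no  c≢x  rewrite ≡ᵇ-≢ c≢x =
    trans (χ-memᵇ v c (λ α β eq → FinP.suc-injective (injective (suc α) (suc β) eq)) (≢e ∘ suc))
          (cong (_+ χ (c ℕ.≡ᵇ e)) (sym (ℤP.+-identityˡ (∑[ α < _ ] χ (c ℕ.≡ᵇ lookup v α)))))

  Ci-loopless : ∀ n J → memᵇ 0 J ≡ false → Firing.Loopless (Ci n J)
  Ci-loopless n J 0∉J v = trans (cong (λ d → memᵇ (d ⊓ (n ∸ d)) J) (ℕP.∣n-n∣≡0 (toℕ v))) 0∉J

  Ci-undirected : ∀ n J → Firing.Undirected (Ci n J)
  Ci-undirected n J v w = cong (λ d → memᵇ (d ⊓ (n ∸ d)) J) (ℕP.∣-∣-comm (toℕ v) (toℕ w))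

  Ci-∑-adjacent : ∀ {n k e} .{{_ : NonZero n}} (js : Vec ℕ k) → e ℕ.+ e ≡ n →
    (∀ α β → lookup js α ≡ lookup js β → α ≡ β) → (∀ α → 0 ℕ.< lookup js α) → (∀ α → lookup js α ℕ.< e) →
    (i : Fin n) (h : ℕ → ℤ) →
    ∑[ v < n ] (edge (Ci n (toList js ++ [ e ])) i v * h (toℕ v)) ≡
    ∑[ α < k ] (h ((toℕ i ℕ.+ lookup js α) % n) + h ((toℕ i ℕ.+ (n ∸ lookup js α)) % n)) + h ((toℕ i ℕ.+ e) % n)
  Ci-∑-adjacent {n} {k} {e} js 2e≡n injective positive <e i h = begin
    ∑[ v < n ] (edge (Ci n J) i v * h (toℕ v))
      ≡⟨ sum-cong-≗ (λ v → trans (cong (_* h (toℕ v)) (χ-memᵇ js (c v) injective ≢e)) (expand v)) ⟩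
    ∑[ v < n ] (∑[ α < k ] at (lookup js α) v + at e v)
      ≡⟨ ∑-distrib-+ (λ v → ∑[ α < k ] at (lookup js α) v) (at e) ⟩
    ∑[ v < n ] ∑[ α < k ] at (lookup js α) v + ∑[ v < n ] at e v
      ≡⟨ cong (_+ ∑[ v < n ] at e v) (∑-comm (λ v α → at (lookup js α) v)) ⟩
    ∑[ α < k ] ∑[ v < n ] at (lookup js α) v + ∑[ v < n ] at e v
      ≡⟨ cong₂ _+_ (sum-cong-≗ λ α → ∑-at-distance h i<n (positive α) (2j<n α)) (∑-at-antipode h i<n 0<e 2e≡n) ⟩
    ∑[ α < k ] (h ((toℕ i ℕ.+ lookup js α) % n) + h ((toℕ i ℕ.+ (n ∸ lookup js α)) % n)) + h ((toℕ i ℕ.+ e) % n) ∎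
    where
    open ≡-Reasoning
    J = toList js ++ [ e ]
    i<n = FinP.toℕ<n i
    c : Fin n → ℕ
    c v = cyclicDist n (toℕ i) (toℕ v)
    at : ℕ → Fin n → ℤ
    at d v = χ (c v ℕ.≡ᵇ d) * h (toℕ v)
    ≢e : ∀ α → lookup js α ≢ e
    ≢e α = ℕP.<⇒≢ (<e α)
    2j<n : ∀ α → lookup js α ℕ.+ lookup js α ℕ.< n
    2j<n α = subst (lookup js α ℕ.+ lookup js α ℕ.<_) 2e≡n (ℕP.+-mono-< (<e α) (<e α))
    0<e : 0 ℕ.< e
    0<e = ℕP.n≢0⇒n>0 λ e≡0 → ℕ.≢-nonZero⁻¹ n (trans (sym 2e≡n) (cong (λ x → x ℕ.+ x) e≡0))
    expand : ∀ v → (∑[ α < k ] χ (c v ℕ.≡ᵇ lookup js α) + χ (c v ℕ.≡ᵇ e)) * h (toℕ v) ≡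
                   ∑[ α < k ] at (lookup js α) v + at e v
    expand v = trans (ℤP.*-distribʳ-+ (h (toℕ v)) (∑[ α < k ] χ (c v ℕ.≡ᵇ lookup js α)) (χ (c v ℕ.≡ᵇ e)))
                     (cong (_+ at e v) (*-distribʳ-sum (h (toℕ v)) (λ α → χ (c v ℕ.≡ᵇ lookup js α))))

  ∸-lipschitz : ∀ s y k → s ∸ y ℕ.≤ k ℕ.+ (s ∸ (y ℕ.+ k))
  ∸-lipschitz s y k = subst (λ t → s ∸ y ℕ.≤ k ℕ.+ t) (ℕP.∸-+-assoc s y k) (ℕP.m≤n+m∸n (s ∸ y) k)

  ∸-convex : ∀ s {y t} → t ℕ.≤ y → (s ∸ y) ℕ.+ (s ∸ y) ℕ.≤ (s ∸ (y ∸ t)) ℕ.+ (s ∸ (y ℕ.+ t))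
  ∸-convex s {y} {t} t≤y with ℕP.≤-total s y
  ... | inj₁ s≤y rewrite ℕP.m≤n⇒m∸n≡0 s≤y = z≤n
  ... | inj₂ y≤s = begin
    (s ∸ y) ℕ.+ (s ∸ y)                  ≤⟨ ℕP.+-monoʳ-≤ (s ∸ y) (∸-lipschitz s y t) ⟩
    (s ∸ y) ℕ.+ (t ℕ.+ (s ∸ (y ℕ.+ t)))  ≡⟨ ℕP.+-assoc (s ∸ y) t _ ⟨
    (s ∸ y) ℕ.+ t ℕ.+ (s ∸ (y ℕ.+ t))    ≤⟨ ℕP.+-monoˡ-≤ (s ∸ (y ℕ.+ t)) (ℕP.m+n≤o⇒m≤o∸n ((s ∸ y) ℕ.+ t) regained) ⟩
    (s ∸ (y ∸ t)) ℕ.+ (s ∸ (y ℕ.+ t))    ∎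
    where
    open ℕP.≤-Reasoning
    regained : (s ∸ y) ℕ.+ t ℕ.+ (y ∸ t) ℕ.≤ s
    regained = ℕP.≤-reflexive (begin-equality
      (s ∸ y) ℕ.+ t ℕ.+ (y ∸ t)     ≡⟨ ℕP.+-assoc (s ∸ y) t (y ∸ t) ⟩
      (s ∸ y) ℕ.+ (t ℕ.+ (y ∸ t))   ≡⟨ cong ((s ∸ y) ℕ.+_) (ℕP.m+[n∸m]≡n t≤y) ⟩
      (s ∸ y) ℕ.+ y                 ≡⟨ ℕP.m∸n+n≡m y≤s ⟩
      s                             ∎)

  firing-balance : ∀ s a d {near far} → near ℕ.≤ ∣ a - d ∣ → far ℕ.≤ a ℕ.+ d →
    (s ∸ a) ℕ.+ (s ∸ a) ℕ.≤ ((d ∸ a) ℕ.+ (d ∸ a)) ℕ.+ ((s ∸ near) ℕ.+ (s ∸ far))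
  firing-balance s a d {near} {far} near≤ far≤ with ℕP.≤-total d a
  ... | inj₁ d≤a rewrite ℕP.m≤n⇒m∸n≡0 d≤a = begin
    (s ∸ a) ℕ.+ (s ∸ a)                  ≤⟨ ∸-convex s d≤a ⟩
    (s ∸ (a ∸ d)) ℕ.+ (s ∸ (a ℕ.+ d))    ≤⟨ ℕP.+-mono-≤ (ℕP.∸-monoʳ-≤ s (subst (near ℕ.≤_) (ℕP.m≤n⇒∣n-m∣≡n∸m d≤a) near≤))
                                                        (ℕP.∸-monoʳ-≤ s far≤) ⟩
    (s ∸ near) ℕ.+ (s ∸ far)             ∎
    where open ℕP.≤-Reasoning
  ... | inj₂ a≤d = begin
    (s ∸ a) ℕ.+ (s ∸ a)                              ≤⟨ ℕP.+-mono-≤ climb climb ⟩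
    (e ℕ.+ (s ∸ d)) ℕ.+ (e ℕ.+ (s ∸ d))              ≡⟨ interchange e (s ∸ d) ⟩
    (e ℕ.+ e) ℕ.+ ((s ∸ d) ℕ.+ (s ∸ d))              ≤⟨ ℕP.+-monoʳ-≤ (e ℕ.+ e) (∸-convex s a≤d) ⟩
    (e ℕ.+ e) ℕ.+ ((s ∸ e) ℕ.+ (s ∸ (d ℕ.+ a)))      ≤⟨ ℕP.+-monoʳ-≤ (e ℕ.+ e)
          (ℕP.+-mono-≤ (ℕP.∸-monoʳ-≤ s (subst (near ℕ.≤_) (ℕP.m≤n⇒∣m-n∣≡n∸m a≤d) near≤))
                       (ℕP.∸-monoʳ-≤ s (subst (far ℕ.≤_) (ℕP.+-comm a d) far≤))) ⟩
    (e ℕ.+ e) ℕ.+ ((s ∸ near) ℕ.+ (s ∸ far))         ∎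
    where
    open ℕP.≤-Reasoning
    e = d ∸ a
    climb : s ∸ a ℕ.≤ e ℕ.+ (s ∸ d)
    climb = subst (λ t → s ∸ a ℕ.≤ e ℕ.+ (s ∸ t)) (ℕP.m+[n∸m]≡n a≤d) (∸-lipschitz s a e)
    interchange : ∀ x y → (x ℕ.+ y) ℕ.+ (x ℕ.+ y) ≡ (x ℕ.+ x) ℕ.+ (y ℕ.+ y)
    interchange = ℕSolver.solve-∀

  firing-balance-strict : ∀ s a {d near} → 0 ℕ.< d → near ℕ.≤ ∣ a - d ∣ → a ℕ.≤ s →
                          0 ℕ.< ((d ∸ a) ℕ.+ (d ∸ a)) ℕ.+ (s ∸ near)
  firing-balance-strict s a {d} {near} 0<d near≤ a≤s with a ℕ.<? d
  ... | yes a<d = ℕP.≤-trans (ℕP.m<n⇒0<n∸m a<d) (ℕP.≤-trans (ℕP.m≤m+n (d ∸ a) (d ∸ a)) (ℕP.m≤m+n _ (s ∸ near)))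
  ... | no  a≮d = ℕP.≤-trans (ℕP.m<n⇒0<n∸m (ℕP.<-≤-trans near<a a≤s)) (ℕP.m≤n+m (s ∸ near) _)
    where
    d≤a = ℕP.≮⇒≥ a≮d
    near<a : near ℕ.< a
    near<a = ℕP.≤-<-trans (subst (near ℕ.≤_) (ℕP.m≤n⇒∣n-m∣≡n∸m d≤a) near≤) (ℕP.∸-monoʳ-< 0<d d≤a)

  -- (d ∸ x) + (d ∸ (x + 1)) runs through the odd numbers 2d − 1, 2d − 3, …, 1.
  ∑-staircase : ∀ n d → ∑[ x < n ] (+ (d ∸ toℕ x) + + (d ∸ suc (toℕ x))) ≤ + (d ℕ.* d)
  ∑-staircase zero    d = +≤+ z≤n
  ∑-staircase (suc n) d = begin
    + (d ℕ.+ (d ∸ 1)) + ∑[ x < n ] (+ (d ∸ suc (toℕ x)) + + (d ∸ suc (suc (toℕ x))))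
      ≡⟨ cong (_+_ (+ (d ℕ.+ (d ∸ 1))))
              (sum-cong-≗ {n} λ x → cong₂ (λ a b → + a + + b) (shift (toℕ x)) (shift (suc (toℕ x)))) ⟩
    + (d ℕ.+ (d ∸ 1)) + ∑[ x < n ] (+ (d ∸ 1 ∸ toℕ x) + + (d ∸ 1 ∸ suc (toℕ x)))
      ≤⟨ ℤP.+-monoʳ-≤ (+ (d ℕ.+ (d ∸ 1))) (∑-staircase n (d ∸ 1)) ⟩
    + (d ℕ.+ (d ∸ 1) ℕ.+ (d ∸ 1) ℕ.* (d ∸ 1))
      ≡⟨ cong +_ (square d) ⟩
    + (d ℕ.* d) ∎
    where
    open ℤP.≤-Reasoning
    shift : ∀ x → d ∸ suc x ≡ d ∸ 1 ∸ x
    shift x = sym (ℕP.∸-+-assoc d 1 x)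
    square : ∀ d → d ℕ.+ (d ∸ 1) ℕ.+ (d ∸ 1) ℕ.* (d ∸ 1) ≡ d ℕ.* d
    square zero    = refl
    square (suc e) = odd e
      where
      odd : ∀ e → suc e ℕ.+ e ℕ.+ e ℕ.* e ≡ suc e ℕ.* suc e
      odd = ℕSolver.solve-∀

  module DistanceToMultiples (m : ℕ) .{{_ : NonZero m}} where

    cyclicNorm : ℕ → ℕ
    cyclicNorm r = r ⊓ (m ∸ r)

    δ : ℕ → ℕ
    δ x = cyclicNorm (x % m)

    δ-periodic : ∀ x → δ (x ℕ.+ m) ≡ δ x
    δ-periodic x = cong cyclicNorm ([m+n]%n≡m%n x m)

    δ-mod : ∀ {n} .{{_ : NonZero n}} → m ∣ n → ∀ x → δ (x % n) ≡ δ x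
    δ-mod {n} m∣n x = cong cyclicNorm (m∣n⇒o%n%m≡o%m m n x m∣n)

    δ-multiple : ∀ q → δ (q ℕ.* m) ≡ 0
    δ-multiple q = cong cyclicNorm (m*n%n≡0 q m)

    cyclicNorm-suc : ∀ r → r ℕ.< m →
                     cyclicNorm (suc r % m) ℕ.≤ suc (cyclicNorm r) × cyclicNorm r ℕ.≤ suc (cyclicNorm (suc r % m))
    cyclicNorm-suc r r<m with suc r ℕ.<? m
    ... | yes 1+r<m rewrite m<n⇒m%n≡m 1+r<m | ℕP.+-∸-assoc 1 (ℕP.<⇒≤ 1+r<m) =
      ℕP.⊓-monoʳ-≤ (suc r) (ℕP.≤-trans (ℕP.n≤1+n _) (ℕP.n≤1+n _)) ,
      ℕP.⊓-monoˡ-≤ (suc (m ∸ suc r)) (ℕP.≤-trans (ℕP.n≤1+n r) (ℕP.n≤1+n _))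
    ... | no  1+r≮m = subst (λ t → cyclicNorm t ℕ.≤ suc (cyclicNorm r) × cyclicNorm r ℕ.≤ suc (cyclicNorm t)) (sym wraps)
                            (z≤n , ℕP.≤-trans (ℕP.m⊓n≤n r (m ∸ r)) (ℕP.≤-reflexive m∸r≡1))
      where
      1+r≡m : suc r ≡ m
      1+r≡m = ℕP.≤-antisym r<m (ℕP.≮⇒≥ 1+r≮m)
      wraps : suc r % m ≡ 0
      wraps = trans (cong (_% m) 1+r≡m) (n%n≡0 m)
      m∸r≡1 : m ∸ r ≡ 1
      m∸r≡1 = trans (cong (_∸ r) (sym 1+r≡m)) (trans (ℕP.+-∸-assoc 1 (ℕP.≤-refl {r})) (cong suc (ℕP.n∸n≡0 r)))

    δ-suc : ∀ x → δ (suc x) ℕ.≤ suc (δ x) × δ x ℕ.≤ suc (δ (suc x))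
    δ-suc x = subst (λ t → cyclicNorm t ℕ.≤ suc (δ x) × δ x ℕ.≤ suc (cyclicNorm t)) (sym suc-%)
                    (cyclicNorm-suc (x % m) (m%n<n x m))
      where
      suc-% : suc x % m ≡ suc (x % m) % m
      suc-% = trans (cong (λ y → suc y % m) (m≡m%n+[m/n]*n x m)) ([m+kn]%n≡m%n (suc (x % m)) (x / m) m)

    δ-+ : ∀ x k → δ (x ℕ.+ k) ℕ.≤ δ x ℕ.+ k × δ x ℕ.≤ δ (x ℕ.+ k) ℕ.+ k
    δ-+ x zero rewrite ℕP.+-identityʳ x | ℕP.+-identityʳ (δ x) = ℕP.≤-refl , ℕP.≤-refl
    δ-+ x (suc k) rewrite ℕP.+-suc x k | ℕP.+-suc (δ x) k | ℕP.+-suc (δ (suc (x ℕ.+ k))) k =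
      ℕP.≤-trans (proj₁ (δ-suc (x ℕ.+ k))) (s≤s (proj₁ (δ-+ x k))) ,
      ℕP.≤-trans (proj₂ (δ-+ x k)) (ℕP.+-monoˡ-≤ k (proj₂ (δ-suc (x ℕ.+ k))))

    δ-lipschitz : ∀ x y → δ x ℕ.≤ δ y ℕ.+ ∣ x - y ∣
    δ-lipschitz x y with ℕP.≤-total x y
    ... | inj₁ x≤y rewrite ℕP.m≤n⇒∣m-n∣≡n∸m x≤y =
      subst (λ t → δ x ℕ.≤ δ t ℕ.+ (y ∸ x)) (ℕP.m+[n∸m]≡n x≤y) (proj₂ (δ-+ x (y ∸ x)))
    ... | inj₂ y≤x rewrite ℕP.m≤n⇒∣n-m∣≡n∸m y≤x =
      subst (λ t → δ t ℕ.≤ δ y ℕ.+ (x ∸ y)) (ℕP.m+[n∸m]≡n y≤x) (proj₁ (δ-+ y (x ∸ y)))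

    δ-attained : ∀ x → Σ[ z ∈ ℕ ] δ z ≡ 0 × (z ℕ.+ δ x ≡ x ⊎ x ℕ.+ δ x ≡ z)
    δ-attained x with r ℕ.≤? m ∸ r
      where r = x % m
    ... | yes r≤m∸r = x / m ℕ.* m , δ-multiple (x / m) , inj₁ (begin
      x / m ℕ.* m ℕ.+ δ x       ≡⟨ cong (x / m ℕ.* m ℕ.+_) (ℕP.m≤n⇒m⊓n≡m r≤m∸r) ⟩
      x / m ℕ.* m ℕ.+ x % m     ≡⟨ ℕP.+-comm (x / m ℕ.* m) (x % m) ⟩
      x % m ℕ.+ x / m ℕ.* m     ≡⟨ m≡m%n+[m/n]*n x m ⟨
      x                         ∎)
      where open ≡-Reasoning
    ... | no  r≰m∸r = suc (x / m) ℕ.* m , δ-multiple (suc (x / m)) , inj₂ (begin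
      x ℕ.+ δ x                             ≡⟨ cong (x ℕ.+_) (ℕP.m≥n⇒m⊓n≡n (ℕP.<⇒≤ (ℕP.≰⇒> r≰m∸r))) ⟩
      x ℕ.+ (m ∸ x % m)                     ≡⟨ cong (ℕ._+ (m ∸ x % m)) (m≡m%n+[m/n]*n x m) ⟩
      x % m ℕ.+ x / m ℕ.* m ℕ.+ (m ∸ x % m) ≡⟨ regroup (x % m) (x / m ℕ.* m) (m ∸ x % m) ⟩
      x % m ℕ.+ (m ∸ x % m) ℕ.+ x / m ℕ.* m ≡⟨ cong (ℕ._+ x / m ℕ.* m) (ℕP.m+[n∸m]≡n (ℕP.<⇒≤ (m%n<n x m))) ⟩
      m ℕ.+ x / m ℕ.* m                     ∎)
      where
      open ≡-Reasoning
      regroup : ∀ a b c → a ℕ.+ b ℕ.+ c ≡ a ℕ.+ c ℕ.+ b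
      regroup = ℕSolver.solve-∀

    δ-toward-zero : ∀ x {d} → d ℕ.≤ m → δ (x ℕ.+ d) ℕ.≤ ∣ δ x - d ∣ ⊎ δ (x ℕ.+ (m ∸ d)) ℕ.≤ ∣ δ x - d ∣
    δ-toward-zero x {d} d≤m with δ-attained x
    ... | z , δz≡0 , inj₁ z+a≡x = inj₂ (begin
      δ (x ℕ.+ (m ∸ d))                                    ≤⟨ δ-lipschitz (x ℕ.+ (m ∸ d)) (z ℕ.+ m) ⟩
      δ (z ℕ.+ m) ℕ.+ ∣ x ℕ.+ (m ∸ d) - z ℕ.+ m ∣          ≡⟨ cong₂ ℕ._+_ (trans (δ-periodic z) δz≡0) distance ⟩
      ∣ δ x - d ∣                                          ∎)
      where
      open ℕP.≤-Reasoning
      a = δ x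
      distance : ∣ x ℕ.+ (m ∸ d) - z ℕ.+ m ∣ ≡ ∣ a - d ∣
      distance = begin-equality
        ∣ x ℕ.+ (m ∸ d) - z ℕ.+ m ∣                   ≡⟨ cong (λ y → ∣ y ℕ.+ (m ∸ d) - z ℕ.+ m ∣) z+a≡x ⟨
        ∣ z ℕ.+ a ℕ.+ (m ∸ d) - z ℕ.+ m ∣             ≡⟨ cong ∣_- z ℕ.+ m ∣ (ℕP.+-assoc z a (m ∸ d)) ⟩
        ∣ z ℕ.+ (a ℕ.+ (m ∸ d)) - z ℕ.+ m ∣           ≡⟨ ℕP.∣m+n-m+o∣≡∣n-o∣ z (a ℕ.+ (m ∸ d)) m ⟩
        ∣ a ℕ.+ (m ∸ d) - m ∣                         ≡⟨ cong₂ ∣_-_∣ (ℕP.+-comm a (m ∸ d)) (sym (ℕP.m∸n+n≡m d≤m)) ⟩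
        ∣ (m ∸ d) ℕ.+ a - (m ∸ d) ℕ.+ d ∣             ≡⟨ ℕP.∣m+n-m+o∣≡∣n-o∣ (m ∸ d) a d ⟩
        ∣ a - d ∣                                     ∎
    ... | z , δz≡0 , inj₂ x+a≡z = inj₁ (begin
      δ (x ℕ.+ d)                          ≤⟨ δ-lipschitz (x ℕ.+ d) z ⟩
      δ z ℕ.+ ∣ x ℕ.+ d - z ∣              ≡⟨ cong₂ ℕ._+_ δz≡0 distance ⟩
      ∣ δ x - d ∣                          ∎)
      where
      open ℕP.≤-Reasoning
      distance : ∣ x ℕ.+ d - z ∣ ≡ ∣ δ x - d ∣
      distance = begin-equality
        ∣ x ℕ.+ d - z ∣              ≡⟨ cong ∣ x ℕ.+ d -_∣ x+a≡z ⟨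
        ∣ x ℕ.+ d - x ℕ.+ δ x ∣      ≡⟨ ℕP.∣m+n-m+o∣≡∣n-o∣ x d (δ x) ⟩
        ∣ d - δ x ∣                  ≡⟨ ℕP.∣-∣-comm d (δ x) ⟩
        ∣ δ x - d ∣                  ∎

    δ-forward : ∀ x d → δ (x ℕ.+ d) ℕ.≤ δ x ℕ.+ d
    δ-forward x d = proj₁ (δ-+ x d)

    δ-backward : ∀ x {d} → d ℕ.≤ m → δ (x ℕ.+ (m ∸ d)) ℕ.≤ δ x ℕ.+ d
    δ-backward x {d} d≤m = subst (λ t → δ (x ℕ.+ (m ∸ d)) ℕ.≤ t ℕ.+ d) (trans (cong δ x+[m∸d]+d≡x+m) (δ-periodic x))
                                 (proj₂ (δ-+ (x ℕ.+ (m ∸ d)) d))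
      where
      x+[m∸d]+d≡x+m : x ℕ.+ (m ∸ d) ℕ.+ d ≡ x ℕ.+ m
      x+[m∸d]+d≡x+m = trans (ℕP.+-assoc x (m ∸ d) d) (cong (x ℕ.+_) (ℕP.m∸n+n≡m d≤m))

    ∑-δ-half : ∀ d → ∑[ x < m ] (+ (d ∸ δ (toℕ x))) ≤ + (d ℕ.* d)
    ∑-δ-half d = begin
      ∑[ x < m ] (+ (d ∸ δ (toℕ x)))
        ≤⟨ ∑-mono-≤ _ _ (λ x → +≤+ (split-min (toℕ x) (FinP.toℕ<n x))) ⟩
      ∑[ x < m ] (+ (d ∸ toℕ x) + + (d ∸ (m ∸ toℕ x)))
        ≡⟨ ∑-distrib-+ {m} (λ x → + (d ∸ toℕ x)) (λ x → + (d ∸ (m ∸ toℕ x))) ⟩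
      ∑[ x < m ] (+ (d ∸ toℕ x)) + ∑[ x < m ] (+ (d ∸ (m ∸ toℕ x)))
        ≡⟨ cong (_+_ (∑[ x < m ] (+ (d ∸ toℕ x))))
                (trans (∑-permute {m} {m} (λ x → + (d ∸ (m ∸ toℕ x))) reverse) (sum-cong-≗ {m} reflect)) ⟩
      ∑[ x < m ] (+ (d ∸ toℕ x)) + ∑[ x < m ] (+ (d ∸ suc (toℕ x)))
        ≡⟨ ∑-distrib-+ {m} (λ x → + (d ∸ toℕ x)) (λ x → + (d ∸ suc (toℕ x))) ⟨
      ∑[ x < m ] (+ (d ∸ toℕ x) + + (d ∸ suc (toℕ x)))
        ≤⟨ ∑-staircase m d ⟩
      + (d ℕ.* d) ∎
      where
      open ℤP.≤-Reasoning
      split-min : ∀ x → x ℕ.< m → d ∸ δ x ℕ.≤ (d ∸ x) ℕ.+ (d ∸ (m ∸ x))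
      split-min x x<m rewrite m<n⇒m%n≡m x<m | ℕP.∸-distribˡ-⊓-⊔ d x (m ∸ x) = ℕP.m⊔n≤m+n (d ∸ x) (d ∸ (m ∸ x))
      reflect : ∀ x → + (d ∸ (m ∸ toℕ (opposite x))) ≡ + (d ∸ suc (toℕ x))
      reflect x = cong (λ y → + (d ∸ y)) (trans (cong (m ∸_) (FinP.opposite-prop x)) (ℕP.m∸[m∸n]≡n (FinP.toℕ<n x)))

    ∑-δ : ∀ d → ∑[ x < m ℕ.+ m ] (+ (d ∸ δ (toℕ x))) ≤ + (d ℕ.* d ℕ.+ d ℕ.* d)
    ∑-δ d = begin
      ∑[ x < m ℕ.+ m ] (+ (d ∸ δ (toℕ x)))
        ≡⟨ ∑-split m m (λ x → + (d ∸ δ x)) ⟩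
      ∑[ x < m ] (+ (d ∸ δ (toℕ x))) + ∑[ x < m ] (+ (d ∸ δ (m ℕ.+ toℕ x)))
        ≡⟨ cong (_+_ (∑[ x < m ] (+ (d ∸ δ (toℕ x))))) (sum-cong-≗ {m} λ x → cong (λ y → + (d ∸ y)) (shift (toℕ x))) ⟩
      ∑[ x < m ] (+ (d ∸ δ (toℕ x))) + ∑[ x < m ] (+ (d ∸ δ (toℕ x)))
        ≤⟨ ℤP.+-mono-≤ (∑-δ-half d) (∑-δ-half d) ⟩
      + (d ℕ.* d ℕ.+ d ℕ.* d) ∎
      where
      open ℤP.≤-Reasoning
      shift : ∀ x → δ (m ℕ.+ x) ≡ δ x
      shift x = trans (cong δ (ℕP.+-comm m x)) (δ-periodic x)

  ∑-quadruple-squares : ∀ {k} (v : Vec ℕ k) →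
    ∑[ α < k ] (+ (4 ℕ.* (lookup v α ℕ.* lookup v α))) ≡ + (4 ℕ.* sumℕ (map (λ j → j ℕ.* j) (toList v)))
  ∑-quadruple-squares []      = refl
  ∑-quadruple-squares (x ∷ v) = trans (cong (_+_ (+ (4 ℕ.* (x ℕ.* x)))) (∑-quadruple-squares v))
                                      (cong +_ (sym (ℕP.*-distribˡ-+ 4 (x ℕ.* x) _)))

  module Construction (m : ℕ) .{{_ : NonZero m}} {k} (js : Vec ℕ (suc k))
    (js-injective : ∀ α β → lookup js α ≡ lookup js β → α ≡ β)
    (js-positive : ∀ α → 0 ℕ.< lookup js α)
    (js-below : ∀ α → lookup js α ℕ.< m) where

    open DistanceToMultiples m

    N : ℕ
    N = m ℕ.+ m

    instance
      N-nonZero : NonZero N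
      N-nonZero = ℕ.>-nonZero (ℕP.≤-trans (ℕ.>-nonZero⁻¹ m) (ℕP.m≤m+n m m))

    G : Graph
    G = Ci N (toList js ++ [ m ])

    open Firing G

    D₀ : Divisor G
    D₀ w = ∑[ α < suc k ] (+ 2 * + (lookup js α ∸ δ (toℕ w)))

    δ-clockwise : ∀ x d → δ ((x ℕ.+ d) % N) ≡ δ (x ℕ.+ d)
    δ-clockwise x d = δ-mod (∣m∣n⇒∣m+n ∣-refl ∣-refl) (x ℕ.+ d)

    δ-anticlockwise : ∀ x {d} → d ℕ.≤ m → δ ((x ℕ.+ (N ∸ d)) % N) ≡ δ (x ℕ.+ (m ∸ d))
    δ-anticlockwise x {d} d≤m = begin
      δ ((x ℕ.+ (N ∸ d)) % N)        ≡⟨ δ-clockwise x (N ∸ d) ⟩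
      δ (x ℕ.+ (N ∸ d))              ≡⟨ cong (λ y → δ (x ℕ.+ y)) (ℕP.+-∸-comm m d≤m) ⟩
      δ (x ℕ.+ ((m ∸ d) ℕ.+ m))      ≡⟨ cong δ (ℕP.+-assoc x (m ∸ d) m) ⟨
      δ (x ℕ.+ (m ∸ d) ℕ.+ m)        ≡⟨ δ-periodic (x ℕ.+ (m ∸ d)) ⟩
      δ (x ℕ.+ (m ∸ d))              ∎
      where open ≡-Reasoning

    module Script (s : ℕ) where

      Φ : ℕ → ℤ
      Φ x = + (s ∸ δ x)

      P : Divisor G
      P w = ∑[ v < N ] (Φ (toℕ v) * Δ v w)

      contribution : ℕ → ℕ → ℤ
      contribution x d = + 2 * + (d ∸ δ x) + ((Φ ((x ℕ.+ d) % N) - Φ x) + (Φ ((x ℕ.+ (N ∸ d)) % N) - Φ x))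

      D₀+P≡∑contribution : ∀ w → D₀ w + P w ≡ ∑[ α < suc k ] contribution (toℕ w) (lookup js α)
      D₀+P≡∑contribution w = begin
        D₀ w + P w
          ≡⟨ cong (_+_ (D₀ w)) (laplacian (Ci-loopless N J 0∉J) (Ci-undirected N J) (Φ ∘ toℕ) w) ⟩
        D₀ w + ∑[ v < N ] (edge G w v * (Φ (toℕ v) - Φ i))
          ≡⟨ cong (_+_ (D₀ w)) (Ci-∑-adjacent js refl js-injective js-positive js-below w (λ x → Φ x - Φ i)) ⟩
        D₀ w + (∑[ α < suc k ] L (lookup js α) + (Φ ((i ℕ.+ m) % N) - Φ i))
          ≡⟨ cong (λ t → D₀ w + (∑[ α < suc k ] L (lookup js α) + t)) antipode-balanced ⟩
        D₀ w + (∑[ α < suc k ] L (lookup js α) + 0ℤ)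
          ≡⟨ cong (_+_ (D₀ w)) (ℤP.+-identityʳ _) ⟩
        D₀ w + ∑[ α < suc k ] L (lookup js α)
          ≡⟨ ∑-distrib-+ (λ α → + 2 * + (lookup js α ∸ δ i)) (λ α → L (lookup js α)) ⟨
        ∑[ α < suc k ] contribution i (lookup js α) ∎
        where
        open ≡-Reasoning
        J = toList js ++ [ m ]
        i = toℕ w
        L : ℕ → ℤ
        L d = (Φ ((i ℕ.+ d) % N) - Φ i) + (Φ ((i ℕ.+ (N ∸ d)) % N) - Φ i)
        0∉J : memᵇ 0 J ≡ false
        0∉J = memᵇ-absent js (λ α → ℕP.<⇒≢ (js-positive α)) (ℕP.<⇒≢ (ℕ.>-nonZero⁻¹ m))
        antipode-balanced : Φ ((i ℕ.+ m) % N) - Φ i ≡ 0ℤ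
        antipode-balanced =
          trans (cong (λ y → + (s ∸ y) - Φ i) (trans (δ-clockwise i m) (δ-periodic i))) (ℤP.+-inverseʳ (Φ i))

      gain : ℕ → ℕ → ℕ
      gain x d = ((d ∸ δ x) ℕ.+ (d ∸ δ x)) ℕ.+ ((s ∸ δ (x ℕ.+ d)) ℕ.+ (s ∸ δ (x ℕ.+ (m ∸ d))))

      loss : ℕ → ℕ
      loss x = (s ∸ δ x) ℕ.+ (s ∸ δ x)

      contribution≡⊖ : ∀ x {d} → d ℕ.≤ m → contribution x d ≡ gain x d ⊖ loss x
      contribution≡⊖ x {d} d≤m = begin
        contribution x d
          ≡⟨ cong₂ (λ p q → + 2 * + (d ∸ δ x) + ((+ (s ∸ p) - Φ x) + (+ (s ∸ q) - Φ x)))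
                   (δ-clockwise x d) (δ-anticlockwise x d≤m) ⟩
        + 2 * + (d ∸ δ x) + ((+ (s ∸ δ (x ℕ.+ d)) - Φ x) + (+ (s ∸ δ (x ℕ.+ (m ∸ d))) - Φ x))
          ≡⟨ collect (+ (d ∸ δ x)) (+ (s ∸ δ (x ℕ.+ d))) (+ (s ∸ δ (x ℕ.+ (m ∸ d)))) (Φ x) ⟩
        + gain x d - + loss x
          ≡⟨ ℤP.[+m]-[+n]≡m⊖n (gain x d) (loss x) ⟩
        gain x d ⊖ loss x ∎
        where
        open ≡-Reasoning
        collect : ∀ a p q f → + 2 * a + ((p - f) + (q - f)) ≡ (a + a + (p + q)) - (f + f)
        collect = solve-∀

      loss≤gain : ∀ x {d} → d ℕ.≤ m → loss x ℕ.≤ gain x d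
      loss≤gain x {d} d≤m with δ-toward-zero x d≤m
      ... | inj₁ near≤ = firing-balance s (δ x) d near≤ (δ-backward x d≤m)
      ... | inj₂ near≤ = subst (λ t → loss x ℕ.≤ ((d ∸ δ x) ℕ.+ (d ∸ δ x)) ℕ.+ t)
                               (ℕP.+-comm (s ∸ δ (x ℕ.+ (m ∸ d))) (s ∸ δ (x ℕ.+ d)))
                               (firing-balance s (δ x) d near≤ (δ-forward x d))

      gain-pos : ∀ x {d} → 0 ℕ.< d → d ℕ.≤ m → δ x ℕ.≤ s → 0 ℕ.< gain x d
      gain-pos x {d} 0<d d≤m δx≤s with δ-toward-zero x d≤m
      ... | inj₁ near≤ = ℕP.≤-trans (firing-balance-strict s (δ x) 0<d near≤ δx≤s)
                                    (ℕP.+-monoʳ-≤ ((d ∸ δ x) ℕ.+ (d ∸ δ x)) (ℕP.m≤m+n _ _))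
      ... | inj₂ near≤ = ℕP.≤-trans (firing-balance-strict s (δ x) 0<d near≤ δx≤s)
                                    (ℕP.+-monoʳ-≤ ((d ∸ δ x) ℕ.+ (d ∸ δ x)) (ℕP.m≤n+m _ _))

      contribution-nonneg : ∀ x {d} → d ℕ.≤ m → 0ℤ ≤ contribution x d
      contribution-nonneg x d≤m =
        subst (0ℤ ≤_) (sym (trans (contribution≡⊖ x d≤m) (ℤP.⊖-≥ (loss≤gain x d≤m)))) (+≤+ z≤n)

      contribution-pos : ∀ x {d} → 0 ℕ.< d → d ℕ.≤ m → δ x ≡ s → 1ℤ ≤ contribution x d
      contribution-pos x {d} 0<d d≤m δx≡s =
        subst (1ℤ ≤_) (sym (trans (contribution≡⊖ x d≤m) no-loss)) (+≤+ (gain-pos x 0<d d≤m (ℕP.≤-reflexive δx≡s)))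
        where
        no-loss : gain x d ⊖ loss x ≡ + gain x d
        no-loss rewrite δx≡s | ℕP.n∸n≡0 s = refl

    chip-at : ∀ q → Σ[ P ∈ Divisor G ] Principal P × Effective {G} (λ w → D₀ w + P w) × 1ℤ ≤ D₀ q + P q
    chip-at q =
      P , script-principal q (λ v → δ (toℕ q) ∸ δ (toℕ v)) , effective , subst (1ℤ ≤_) (sym (D₀+P≡∑contribution q)) at-q
      where
      open Script (δ (toℕ q))
      effective : Effective {G} (λ w → D₀ w + P w)
      effective w = subst (0ℤ ≤_) (sym (D₀+P≡∑contribution w))
                          (∑-nonneg _ λ α → contribution-nonneg (toℕ w) (ℕP.<⇒≤ (js-below α)))
      at-q : 1ℤ ≤ ∑[ α < suc k ] contribution (toℕ q) (lookup js α)
      at-q = ℤP.+-mono-≤ (contribution-pos (toℕ q) (js-positive zero) (ℕP.<⇒≤ (js-below zero)) refl)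
                         (∑-nonneg _ λ α → contribution-nonneg (toℕ q) (ℕP.<⇒≤ (js-below (suc α))))

    positive-rank : PositiveRank G D₀
    positive-rank = positiveRank-by-principal D₀ chip-at

    degree : deg {G} D₀ ≤ + (4 ℕ.* sumℕ (map (λ j → j ℕ.* j) (toList js)))
    degree = begin
      deg {G} D₀
        ≡⟨ sumFin≡sum D₀ ⟩
      ∑[ w < N ] ∑[ α < suc k ] (+ 2 * + (lookup js α ∸ δ (toℕ w)))
        ≡⟨ ∑-comm {N} {suc k} (λ w α → + 2 * + (lookup js α ∸ δ (toℕ w))) ⟩
      ∑[ α < suc k ] ∑[ w < N ] (+ 2 * + (lookup js α ∸ δ (toℕ w)))
        ≡⟨ sum-cong-≗ {suc k} (λ α → *-distribˡ-sum {N} (+ 2) (λ w → + (lookup js α ∸ δ (toℕ w)))) ⟨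
      ∑[ α < suc k ] (+ 2 * ∑[ w < N ] (+ (lookup js α ∸ δ (toℕ w))))
        ≤⟨ ∑-mono-≤ {suc k} _ _ (λ α → ℤP.*-monoˡ-≤-nonNeg (+ 2) (∑-δ (lookup js α))) ⟩
      ∑[ α < suc k ] (+ 2 * + (lookup js α ℕ.* lookup js α ℕ.+ lookup js α ℕ.* lookup js α))
        ≡⟨ sum-cong-≗ {suc k} (λ α → quadruple (lookup js α ℕ.* lookup js α)) ⟩
      ∑[ α < suc k ] (+ (4 ℕ.* (lookup js α ℕ.* lookup js α)))
        ≡⟨ ∑-quadruple-squares js ⟩
      + (4 ℕ.* sumℕ (map (λ j → j ℕ.* j) (toList js))) ∎
      where
      open ℤP.≤-Reasoning
      quadruple : ∀ y → + 2 * + (y ℕ.+ y) ≡ + (4 ℕ.* y)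
      quadruple y = trans (sym (ℤP.pos-* 2 (y ℕ.+ y))) (cong +_ (double y))
        where
        double : ∀ y → 2 ℕ.* (y ℕ.+ y) ≡ 4 ℕ.* y
        double = ℕSolver.solve-∀

    gonality-bound : GonLe G (+ (4 ℕ.* sumℕ (map (λ j → j ℕ.* j) (toList js))))
    gonality-bound = D₀ , positive-rank , degree

  strictlyIncreasing⇒injective : ∀ {k} (v : Vec ℕ k) → (∀ a b → a Data.Fin.< b → lookup v a ℕ.< lookup v b) →
                                 ∀ a b → lookup v a ≡ lookup v b → a ≡ b
  strictlyIncreasing⇒injective v increasing a b va≡vb with FinP.<-cmp a b
  ... | tri< a<b _ _ = contradiction va≡vb (ℕP.<⇒≢ (increasing a b a<b))
  ... | tri≈ _ a≡b _ = a≡b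
  ... | tri> _ _ b<a = contradiction (sym va≡vb) (ℕP.<⇒≢ (increasing b a b<a))

open ChipFiring using (strictlyIncreasing⇒injective; module Construction)

open import Data.Nat using (ℕ; suc; _<_; _*_; _+_; _/_)
open import Data.Nat.Divisibility using (_∣_)
open import Data.Integer using (+_)
open import Data.Fin using (Fin)
open import Data.Vec using (Vec; lookup; toList)
open import Data.List using (List; map; _++_; [_])
open import Data.Fin using (zero)
open import Data.Nat.DivMod using (m*n/n≡m)
open import Data.Nat.Divisibility using (divides)
import Data.Nat.Properties as ℕP
import Data.Nat.Tactic.RingSolver as ℕSolver
open import Relation.Binary.PropositionalEquality using (_≡_; refl; sym; subst; subst₂)
open import Relation.Nullary using (contradiction)

theorem3p3 : (n : ℕ) → 2 ∣ n → (k : ℕ) → (js : Vec ℕ (suc k)) →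
    (∀ (a b : Fin (suc k)) → a Data.Fin.< b → lookup js a < lookup js b) →
    (∀ (a : Fin (suc k)) → 0 < lookup js a) →
    (∀ (a : Fin (suc k)) → 2 * lookup js a < n) →
    Connected (Ci n (toList js ++ [ n / 2 ])) →
    GonLe (Ci n (toList js ++ [ n / 2 ])) (+ (4 * sumℕ (map (λ j → j * j) (toList js))))
theorem3p3 .(0 * 2) (divides 0 refl) k js increasing positive small _ = contradiction (small zero) ℕP.n≮0
theorem3p3 .(suc h * 2) (divides (suc h) refl) k js increasing positive small _ =
  subst₂ (λ n e → GonLe (Ci n (toList js ++ [ e ])) (+ (4 * sumℕ (map (λ j → j * j) (toList js)))))
         (double (suc h)) (sym (m*n/n≡m (suc h) 2))
         (Construction.gonality-bound (suc h) js (strictlyIncreasing⇒injective js increasing) positive below)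
  where
  double : ∀ x → x + x ≡ x * 2
  double = ℕSolver.solve-∀
  below : ∀ a → lookup js a < suc h
  below a = ℕP.*-cancelʳ-< 2 (lookup js a) (suc h) (subst (_< suc h * 2) (ℕP.*-comm 2 (lookup js a)) (small a))
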